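{- $\{11184810s+992077 : s=0,1,2,\dots\}\subseteq\mathcal{U}$.
   Context: $\mathcal{U}$ denotes the set of positive odd integers $n$ that cannot be written as $n=p+2^k$ with $p$ a prime and $k$ a positive integer. -}

module Defs where

open import Data.Nat using (ℕ; suc; _+_; _*_; _^_)
open import Data.Nat.Primality using (Prime)
open import Data.Product using (Σ; _×_)
open import Relation.Binary.PropositionalEquality using (_≡_)
open import Relation.Nullary using (¬_)

Odd : ℕ → Set
Odd n = Σ ℕ λ m → n ≡ 2 * m + 1

PrimePlusPow2 : ℕ → Set
PrimePlusPow2 n = Σ ℕ λ p → Σ ℕ λ j → Prime p × n ≡ p + 2 ^ suc j

-- 𝒰 : positive odd integers not of the form p + 2^k (p prime, k ≥ 1)
-- (odd naturals are automatically positive)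
InU : ℕ → Set
InU n = Odd n × ¬ PrimePlusPow2 n

-- Put M = 11184810 = 2 · 3 · 5 · 7 · 13 · 17 · 241 and c = 992077. Since 3M = 2(2²⁴ − 1),
-- the powers 2ᵏ (k ≥ 1) are periodic modulo M with period 24. For each of the 24 residue
-- classes of k there is a prime q ∣ M with 2ᵏ ≡ c (mod q), the classes forming the covering
-- system 0 mod 2 (q = 3), 1 mod 4 (5), 1 mod 3 (7), 3 mod 12 (13), 3 mod 8 (17), 23 mod 24 (241).
-- So if n ≡ c (mod M) and n = p + 2ᵏ with p prime, then q ∣ p, hence p = q; but n ≡ q + 2ᵏ (mod M)
-- fails for each of the 24 pairs (k mod 24, q), which is a finite computation.
module Submission where

open import Defs
open import Data.Nat using (ℕ; zero; suc; _+_; _*_; _^_; NonZero)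
open import Data.Nat.Properties
open import Algebra.Properties.CommutativeSemigroup +-commutativeSemigroup using (x∙yz≈xz∙y)
open import Data.Nat.DivMod
open import Data.Nat.Divisibility
open import Data.Nat.Primality using (Prime; prime⇒irreducible)
open import Data.Nat.Tactic.RingSolver using (solve-∀)
open import Data.Fin using (Fin; toℕ)
open import Data.Fin.Properties using (all?; toℕ-fromℕ<)
open import Data.Vec using (_∷_; []; lookup)
open import Data.Product using (_,_)
open import Data.Empty using (⊥)
open import Data.Sum using (inj₁; inj₂)
open import Function using (_∘_)
open import Relation.Binary.PropositionalEquality
open import Relation.Nullary using (¬_; Dec; yes; no; ¬?; contradiction)
open import Relation.Nullary.Decidable using (_×-dec_; map′; from-yes)

open ≡-Reasoning

[m+n]%d≡n%d⇒d∣m : ∀ m n d .{{_ : NonZero d}} → (m + n) % d ≡ n % d → d ∣ m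
[m+n]%d≡n%d⇒d∣m m n d eq = ∣m+n∣m⇒∣n (divides ((m + n) / d) m+[n/d]*d≡[[m+n]/d]*d) (n∣m*n (n / d))
  where
  m+[n/d]*d≡[[m+n]/d]*d : n / d * d + m ≡ (m + n) / d * d
  m+[n/d]*d≡[[m+n]/d]*d = +-cancelˡ-≡ (n % d) _ _ (begin
    n % d + (n / d * d + m)        ≡⟨ sym (+-assoc (n % d) _ m) ⟩
    n % d + n / d * d + m          ≡⟨ cong (_+ m) (sym (m≡m%n+[m/n]*n n d)) ⟩
    n + m                          ≡⟨ +-comm n m ⟩
    m + n                          ≡⟨ m≡m%n+[m/n]*n (m + n) d ⟩
    (m + n) % d + (m + n) / d * d  ≡⟨ cong (_+ (m + n) / d * d) eq ⟩
    n % d + (m + n) / d * d        ∎)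

[m+n%d]%d≡[m+n]%d : ∀ m n d .{{_ : NonZero d}} → (m + n % d) % d ≡ (m + n) % d
[m+n%d]%d≡[m+n]%d m n d = begin
  (m + n % d) % d          ≡⟨ %-distribˡ-+ m (n % d) d ⟩
  (m % d + n % d % d) % d  ≡⟨ cong (λ x → (m % d + x) % d) (m%n%n≡m%n n d) ⟩
  (m % d + n % d) % d      ≡⟨ sym (%-distribˡ-+ m n d) ⟩
  (m + n) % d              ∎

%-periodic : ∀ (f : ℕ → ℕ) P n .{{_ : NonZero P}} .{{_ : NonZero n}} →
             (∀ m → f (m + P) % n ≡ f m % n) → ∀ m → f m % n ≡ f (m % P) % n
%-periodic f P n f-periodic m = begin
  f m % n                    ≡⟨ cong (λ x → f x % n) (m≡m%n+[m/n]*n m P) ⟩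
  f (m % P + m / P * P) % n  ≡⟨ shift (m / P) (m % P) ⟩
  f (m % P) % n              ∎
  where
  shift : ∀ q r → f (r + q * P) % n ≡ f r % n
  shift zero    r = cong (λ x → f x % n) (+-identityʳ r)
  shift (suc q) r = begin
    f (r + (P + q * P)) % n  ≡⟨ cong (λ x → f x % n) (x∙yz≈xz∙y r P (q * P)) ⟩
    f (r + q * P + P) % n    ≡⟨ f-periodic (r + q * P) ⟩
    f (r + q * P) % n        ≡⟨ shift q r ⟩
    f r % n                  ∎

M : ℕ
M = 11184810

c : ℕ
c = 992077

2^[1+m+24]≡2^[1+m]+[2^m*3]*M : ∀ m → 2 ^ suc (m + 24) ≡ 2 ^ suc m + 2 ^ m * 3 * M
2^[1+m+24]≡2^[1+m]+[2^m*3]*M m = begin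
  2 ^ (suc m + 24)          ≡⟨ ^-distribˡ-+-* 2 (suc m) 24 ⟩
  2 * 2 ^ m * 16777216      ≡⟨ 2^24-identity (2 ^ m) ⟩
  2 * 2 ^ m + 2 ^ m * 3 * M ∎
  where
  2^24-identity : ∀ x → 2 * x * 16777216 ≡ 2 * x + x * 3 * 11184810
  2^24-identity = solve-∀

2^[1+j]%M≡2^[1+j%24]%M : ∀ j → 2 ^ suc j % M ≡ 2 ^ suc (j % 24) % M
2^[1+j]%M≡2^[1+j%24]%M = %-periodic (λ j → 2 ^ suc j) 24 M λ m → begin
  2 ^ suc (m + 24) % M              ≡⟨ cong (_% M) (2^[1+m+24]≡2^[1+m]+[2^m*3]*M m) ⟩
  (2 ^ suc m + 2 ^ m * 3 * M) % M   ≡⟨ [m+kn]%n≡m%n (2 ^ suc m) (2 ^ m * 3) M ⟩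
  2 ^ suc m % M                     ∎

record Covers (q k : ℕ) : Set where
  field
    {{q≢0}}  : NonZero q
    q≢1      : q ≢ 1
    q∣M      : q ∣ M
    c≡2^k    : c % q ≡ 2 ^ k % q
    q+2^k≢c  : (q + 2 ^ k % M) % M ≢ c

covers? : ∀ q k → Dec (Covers q k)
covers? q k with nonZero? q
... | no q≡0 = no (q≡0 ∘ Covers.q≢0)
... | yes q≢0 = map′
  (λ (q≢1 , q∣M , c≡2^k , q+2^k≢c) → record { q≢1 = q≢1 ; q∣M = q∣M ; c≡2^k = c≡2^k ; q+2^k≢c = q+2^k≢c })
  (λ cov → let open Covers cov in q≢1 , q∣M , c≡2^k , q+2^k≢c)
  (¬? (q ≟ 1) ×-dec q ∣? M ×-dec c % q ≟ 2 ^ k % q ×-dec ¬? ((q + 2 ^ k % M) % M ≟ c))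
  where instance _ = q≢0

coveringPrime : Fin 24 → ℕ
coveringPrime = lookup (5 ∷ 3 ∷ 13 ∷ 3 ∷ 5 ∷ 3 ∷ 7 ∷ 3 ∷ 5 ∷ 3 ∷ 17 ∷ 3 ∷
                        5 ∷ 3 ∷ 13 ∷ 3 ∷ 5 ∷ 3 ∷ 7 ∷ 3 ∷ 5 ∷ 3 ∷ 241 ∷ 3 ∷ [])

covering : ∀ i → Covers (coveringPrime i) (suc (toℕ i))
covering = from-yes (all? λ i → covers? (coveringPrime i) (suc (toℕ i)))

covers⇒≢p+2^k : ∀ {n p k q k′} → n % M ≡ c → Prime p → n ≡ p + 2 ^ k →
                   2 ^ k % M ≡ 2 ^ k′ % M → Covers q k′ → ⊥
covers⇒≢p+2^k {n} {p} {k} {q} {k′} n%M≡c p-prime n≡p+2^k 2^k≡2^k′ cov = q+2^k≢c (begin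
  (q + 2 ^ k′ % M) % M  ≡⟨ cong (λ x → (q + x) % M) (sym 2^k≡2^k′) ⟩
  (q + 2 ^ k % M) % M   ≡⟨ [m+n%d]%d≡[m+n]%d q (2 ^ k) M ⟩
  (q + 2 ^ k) % M       ≡⟨ cong (λ x → (x + 2 ^ k) % M) q≡p ⟩
  (p + 2 ^ k) % M       ≡⟨ cong (_% M) (sym n≡p+2^k) ⟩
  n % M                 ≡⟨ n%M≡c ⟩
  c                     ∎)
  where
  open Covers cov

  q∣p : q ∣ p
  q∣p = [m+n]%d≡n%d⇒d∣m p (2 ^ k) q (begin
    (p + 2 ^ k) % q   ≡⟨ cong (_% q) (sym n≡p+2^k) ⟩
    n % q             ≡⟨ sym (m∣n⇒o%n%m≡o%m q M n q∣M) ⟩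
    n % M % q         ≡⟨ cong (_% q) n%M≡c ⟩
    c % q             ≡⟨ c≡2^k ⟩
    2 ^ k′ % q        ≡⟨ sym (m∣n⇒o%n%m≡o%m q M (2 ^ k′) q∣M) ⟩
    2 ^ k′ % M % q    ≡⟨ cong (_% q) (sym 2^k≡2^k′) ⟩
    2 ^ k % M % q     ≡⟨ m∣n⇒o%n%m≡o%m q M (2 ^ k) q∣M ⟩
    2 ^ k % q         ∎)

  q≡p : q ≡ p
  q≡p with prime⇒irreducible p-prime q∣p
  ... | inj₁ q≡1 = contradiction q≡1 q≢1
  ... | inj₂ q≡p = q≡p

%M≡c⇒¬PrimePlusPow2 : ∀ n → n % M ≡ c → ¬ PrimePlusPow2 n
%M≡c⇒¬PrimePlusPow2 n n%M≡c (p , j , p-prime , n≡p+2^[1+j]) =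
  covers⇒≢p+2^k {k = suc j} n%M≡c p-prime n≡p+2^[1+j] 2^[1+j]≡2^[1+i] (covering i)
  where
  i = j mod 24
  2^[1+j]≡2^[1+i] : 2 ^ suc j % M ≡ 2 ^ suc (toℕ i) % M
  2^[1+j]≡2^[1+i] = trans (2^[1+j]%M≡2^[1+j%24]%M j)
                          (cong (λ x → 2 ^ suc x % M) (sym (toℕ-fromℕ< (m%n<n j 24))))

lemma2 : (s : ℕ) → InU (11184810 * s + 992077)
lemma2 s = (5592405 * s + 496038 , odd s) , %M≡c⇒¬PrimePlusPow2 _ (%-remove-+ˡ c (m∣m*n s))
  where
  odd : ∀ s → 11184810 * s + 992077 ≡ 2 * (5592405 * s + 496038) + 1
  odd = solve-∀
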